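{- Let $G$ be a locally finite connected graph and let $(A,B)$ and $(A',B')$ be two tight separations of $G$. Then $(A',B')$ is either nested with $(A,B)$, or its separator $A'\cap B'$ is a $\subseteq$-minimal $x$–$y$-separator in $G$ for some pair $x,y$ of vertices from $(A\cap B)\cup N(A\cap B)$.
   Context: A separation of $G=(V,E)$ is a pair $(A,B)$ with $A\cup B=V$ and no edge between $A\smallsetminus B$ and $B\smallsetminus A$; separator $A\cap B$. $(A,B)\le(C,D)$ iff $A\subseteq C$ and $B\supseteq D$; two separations are nested if suitable orientations (each of $(A,B),(B,A)$) are comparable. For $X\subseteq V$, a component $C$ of $G-X$ is tight if $N(C)=X$; a separation $(A,B)$ is tight if each of $A\smallsetminus B$ and $B\smallsetminus A$ contains a tight component of $G-(A\cap B)$. For vertices $x,y$, an $x$–$y$-separator is a set $X\subseteq V\smallsetminus\{x,y\}$ such that $x$ and $y$ lie in different components of $G-X$. -}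

module Defs where

open import Data.Product using (Σ; ∃; _×_; _,_)
open import Data.Sum using (_⊎_)
open import Data.Unit using (⊤)
open import Data.Empty using (⊥)
open import Data.List using (List)
open import Data.List.Membership.Propositional using (_∈_)
open import Relation.Nullary using (¬_)
open import Relation.Binary.PropositionalEquality using (_≡_)

record Graph : Set₁ where
  field
    V      : Set
    E      : V → V → Set
    E-sym  : ∀ {u v} → E u v → E v u
    E-irr  : ∀ {v} → ¬ E v v

VSet : Graph → Set₁
VSet G = Graph.V G → Set

module _ (G : Graph) where
  open Graph G

  _⊆_ : VSet G → VSet G → Set
  S ⊆ T = ∀ v → S v → T v

  _∩_ : VSet G → VSet G → VSet G
  (S ∩ T) v = S v × T v

  _∪_ : VSet G → VSet G → VSet G
  (S ∪ T) v = S v ⊎ T v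

  _∖_ : VSet G → VSet G → VSet G
  (S ∖ T) v = S v × ¬ T v

  N : VSet G → VSet G
  N S v = ¬ S v × ∃ λ u → S u × E v u

  -- walks all of whose vertices satisfy P (i.e. walks in the subgraph G[P])
  data Walk (P : VSet G) : V → V → Set where
    here : ∀ {u} → P u → Walk P u u
    step : ∀ {u v w} → P u → E u v → Walk P v w → Walk P u w

  All : VSet G
  All _ = ⊤

  LocallyFinite : Set
  LocallyFinite = ∀ v → ∃ λ (xs : List V) → ∀ u → E v u → u ∈ xs

  Connected : Set
  Connected = ∀ u v → Walk All u v

  Outside : VSet G → VSet G
  Outside X v = ¬ X v

  -- C is a component of G - X: nonempty, avoids X, connected in G - X,
  -- and maximal (closed under edges of G - X).
  IsComponent : VSet G → VSet G → Set
  IsComponent X C =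
      (∃ λ v → C v)
    × (C ⊆ Outside X)
    × (∀ u v → C u → C v → Walk C u v)
    × (∀ u v → C u → ¬ X v → E u v → C v)

  Tight : VSet G → VSet G → Set
  Tight X C = (N C ⊆ X) × (X ⊆ N C)

  IsSeparation : VSet G → VSet G → Set
  IsSeparation A B =
      (∀ v → (A ∪ B) v)
    × (∀ u v → (A ∖ B) u → (B ∖ A) v → ¬ E u v)

  IsTightSeparation : VSet G → VSet G → Set₁
  IsTightSeparation A B =
      IsSeparation A B
    × (∃ λ C → IsComponent (A ∩ B) C × Tight (A ∩ B) C × C ⊆ (A ∖ B))
    × (∃ λ C → IsComponent (A ∩ B) C × Tight (A ∩ B) C × C ⊆ (B ∖ A))

  SepLeq : VSet G → VSet G → VSet G → VSet G → Set
  SepLeq A B C D = (A ⊆ C) × (D ⊆ B)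

  Nested : VSet G → VSet G → VSet G → VSet G → Set
  Nested A B C D =
      SepLeq A B C D ⊎ SepLeq A B D C ⊎ SepLeq B A C D ⊎ SepLeq B A D C
    ⊎ SepLeq C D A B ⊎ SepLeq C D B A ⊎ SepLeq D C A B ⊎ SepLeq D C B A

  IsSeparator : V → V → VSet G → Set
  IsSeparator x y X =
      ¬ X x × ¬ X y × ¬ Walk (Outside X) x y

  IsMinimalSeparator : V → V → VSet G → Set₁
  IsMinimalSeparator x y X =
      IsSeparator x y X
    × (∀ Y → Y ⊆ X → IsSeparator x y Y → X ⊆ Y)

module Submission where

-- Let X = A ∩ B and X' = A' ∩ B', with tight components D₁ ⊆ A' ∖ B' and
-- D₂ ⊆ B' ∖ A' of G − X'. Every vertex of X' has a neighbour in D₁ and one in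
-- D₂, so X' is a minimal separator between any vertex of D₁ and any vertex of
-- D₂; this settles the case where both meet X ∪ N(X). Otherwise some tight
-- component D avoids X ∪ N(X). Being connected, D lies in one strict side of
-- (A,B), say A ∖ B, and then X' = N(D) ⊆ A ∖ B as D avoids N(X). The other side
-- B is connected through its own tight component and misses X', so it lies in
-- one strict side of (A',B'), which makes the two separations nested.

open import Defs
open import Axiom.ExcludedMiddle using (ExcludedMiddle)
open import Level using (0ℓ)
open import Data.Product using (∃; _×_; _,_; proj₁; proj₂; swap)
open import Data.Sum using (_⊎_; inj₁; inj₂; [_,_]′)
import Data.Sum as Sum
open import Data.Empty using (⊥-elim)
open import Function using (_∘_)
open import Relation.Nullary using (¬_; yes; no)

module _ {G : Graph} where
  open Graph G

  private
    variable
      A B A' B' C D S X Y : VSet G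

  Linked : VSet G → Set
  Linked C = ∀ u v → C u → C v → Walk G C u v

  Walk-mono : ∀ {P Q : VSet G} → _⊆_ G P Q → ∀ {u w} → Walk G P u w → Walk G Q u w
  Walk-mono P⊆Q (here p)     = here (P⊆Q _ p)
  Walk-mono P⊆Q (step p e w) = step (P⊆Q _ p) e (Walk-mono P⊆Q w)

  Walk-head : ∀ {P : VSet G} {u w} → Walk G P u w → P u
  Walk-head (here p)     = p
  Walk-head (step p _ _) = p

  _++_ : ∀ {P : VSet G} {u v w} → Walk G P u v → Walk G P v w → Walk G P u w
  here _     ++ w' = w'
  step p e w ++ w' = step p e (w ++ w')

  reverse : ∀ {P : VSet G} {u v} → Walk G P u v → Walk G P v u
  reverse (here p)     = here p
  reverse (step p e w) = reverse w ++ step (Walk-head w) (E-sym e) (here p)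

  Outside-antitone : _⊆_ G Y X → _⊆_ G S (Outside G X) → _⊆_ G S (Outside G Y)
  Outside-antitone Y⊆X S∩X=∅ u u∈ = S∩X=∅ u u∈ ∘ Y⊆X u

  N-∩-comm : _⊆_ G (N G (_∩_ G B A)) (N G (_∩_ G A B))
  N-∩-comm _ (v∉ , u , u∈ , e) = v∉ ∘ swap , u , swap u∈ , e

  sep-swap : IsSeparation G A B → IsSeparation G B A
  sep-swap (covers , no-edge) =
    (λ v → Sum.swap (covers v)) , λ u v u∈ v∈ e → no-edge v u v∈ u∈ (E-sym e)

  strict-left : IsSeparation G A B → ∀ {v} → ¬ B v → _∖_ G A B v
  strict-left (covers , _) {v} ¬b = [ (λ a → a , ¬b) , (λ b → ⊥-elim (¬b b)) ]′ (covers v)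

  strict-side : IsSeparation G A B → ∀ {v} → ¬ _∩_ G A B v → _∖_ G A B v ⊎ _∖_ G B A v
  strict-side (covers , _) {v} v∉X with covers v
  ... | inj₁ a = inj₁ (a , λ b → v∉X (a , b))
  ... | inj₂ b = inj₂ (b , λ a → v∉X (a , b))

  step-stays : IsSeparation G A B → ∀ {u v} → _∖_ G A B u → E u v → ¬ _∩_ G A B v → _∖_ G A B v
  step-stays sep@(_ , no-edge) u∈ e v∉X with strict-side sep v∉X
  ... | inj₁ v∈ = v∈
  ... | inj₂ v∈ = ⊥-elim (no-edge _ _ u∈ v∈ e)

  walk-stays : IsSeparation G A B → ∀ {P} → _⊆_ G P (Outside G (_∩_ G A B))
             → ∀ {u w} → Walk G P u w → _∖_ G A B u → _∖_ G A B w
  walk-stays sep P∩X=∅ (here _)     u∈ = u∈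
  walk-stays sep P∩X=∅ (step _ e w) u∈ =
    walk-stays sep P∩X=∅ w (step-stays sep u∈ e (P∩X=∅ _ (Walk-head w)))

  separator-separates : IsSeparation G A B → ∀ {x y} → _∖_ G A B x → _∖_ G B A y
                      → IsSeparator G x y (_∩_ G A B)
  separator-separates sep x∈ y∈ =
      proj₂ x∈ ∘ proj₂
    , proj₂ y∈ ∘ proj₁
    , λ w → proj₂ y∈ (proj₁ (walk-stays sep (λ _ v∉ → v∉) w x∈))

  ≤-if-right-in-strict-side : IsSeparation G A B → _⊆_ G B (_∖_ G C D) → SepLeq G B A C D
  ≤-if-right-in-strict-side (covers , _) B⊆ =
      (λ v b → proj₁ (B⊆ v b))
    , λ v d → [ (λ a → a) , (λ b → ⊥-elim (proj₂ (B⊆ v b) d)) ]′ (covers v)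

  hub-in-one-side : IsSeparation G A B → ∀ {c} → _⊆_ G S (Outside G (_∩_ G A B))
                  → (∀ v → S v → Walk G S v c) → S c
                  → _⊆_ G S (_∖_ G A B) ⊎ _⊆_ G S (_∖_ G B A)
  hub-in-one-side sep S∩X=∅ to-c c∈ with strict-side sep (S∩X=∅ _ c∈)
  ... | inj₁ c∈A = inj₁ λ v v∈ → walk-stays sep S∩X=∅ (reverse (to-c v v∈)) c∈A
  ... | inj₂ c∈B = inj₂ λ v v∈ →
    walk-stays (sep-swap sep) (λ u s → S∩X=∅ u s ∘ swap) (reverse (to-c v v∈)) c∈B

  N-of-interior : IsSeparation G A B → _⊆_ G D (_∖_ G A B)
                → _⊆_ G D (Outside G (N G (_∩_ G A B))) → _⊆_ G (N G D) (_∖_ G A B)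
  N-of-interior {A = A} {B} (covers , no-edge) D⊆ D∩NX=∅ v (_ , u , u∈D , e) =
    [ (λ a → a , λ b → v∉X (a , b))
    , (λ b → ⊥-elim (no-edge u v (D⊆ u u∈D) (b , λ a → v∉X (a , b)) (E-sym e))) ]′ (covers v)
    where
    v∉X : ¬ _∩_ G A B v
    v∉X v∈X = D∩NX=∅ u u∈D (proj₂ (D⊆ u u∈D) ∘ proj₂ , v , v∈X , E-sym e)

  exit-through-separator : ExcludedMiddle 0ℓ → IsSeparation G A B → ∀ {P v t}
                         → Walk G P v t → B v → _∖_ G A B t
                         → ∃ λ x → _∩_ G A B x × Walk G B v x
  exit-through-separator em sep (here _) b (_ , ¬b) = ⊥-elim (¬b b)
  exit-through-separator {A = A} {B} em sep (step {v} {v'} _ e w) b t∈ with em {A v} | em {B v'}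
  ... | yes a | _      = v , (a , b) , here b
  ... | no ¬a | no ¬b' = ⊥-elim (proj₂ sep v' v (strict-left sep ¬b') (b , ¬a) (E-sym e))
  ... | no _  | yes b' with exit-through-separator em sep w b' t∈
  ...   | x , x∈X , v'⇝x = x , x∈X , step b e v'⇝x

  walks-into-tight-side : ExcludedMiddle 0ℓ → Connected G → IsSeparation G A B
                        → ∀ {t c} → _∖_ G A B t → _⊆_ G C B → Linked C → C c
                        → _⊆_ G (_∩_ G A B) (N G C) → ∀ v → B v → Walk G B v c
  walks-into-tight-side em conn sep t∈ C⊆B linked c∈ X⊆NC v b
    with exit-through-separator em sep (conn v _) b t∈
  ... | x , x∈X , v⇝x with X⊆NC x x∈X
  ...   | _ , u , u∈C , e = v⇝x ++ step (proj₂ x∈X) e (Walk-mono C⊆B (linked u _ u∈C c∈))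

  nested-if-separator-in-strict-side
    : ExcludedMiddle 0ℓ → Connected G → IsSeparation G A B
    → ∀ {t c} → _∖_ G A B t → _⊆_ G C (_∖_ G B A) → Linked C → C c
    → _⊆_ G (_∩_ G A B) (N G C)
    → IsSeparation G A' B' → _⊆_ G (_∩_ G A' B') (_∖_ G A B)
    → SepLeq G B A A' B' ⊎ SepLeq G B A B' A'
  nested-if-separator-in-strict-side em conn sep t∈ C⊆ linked c∈ X⊆NC sep' X'⊆ =
    Sum.map (≤-if-right-in-strict-side sep) (≤-if-right-in-strict-side sep)
      (hub-in-one-side sep' (λ v b x' → proj₂ (X'⊆ v x') b)
        (walks-into-tight-side em conn sep t∈ (λ u → proj₁ ∘ C⊆ u) linked c∈ X⊆NC)
        (proj₁ (C⊆ _ c∈)))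

  nested-if-tight-component-avoids
    : ExcludedMiddle 0ℓ → Connected G
    → IsTightSeparation G A B → IsSeparation G A' B'
    → IsComponent G (_∩_ G A' B') D → Tight G (_∩_ G A' B') D
    → _⊆_ G D (Outside G (_∪_ G (_∩_ G A B) (N G (_∩_ G A B))))
    → Nested G A B A' B'
  nested-if-tight-component-avoids em conn
    (sep , (C₁ , ((c₁ , c₁∈) , _ , linked₁ , _) , (_ , X⊆NC₁) , C₁⊆)
         , (C₂ , ((c₂ , c₂∈) , _ , linked₂ , _) , (_ , X⊆NC₂) , C₂⊆))
    sep' ((d , d∈) , _ , linked , _) (_ , X'⊆ND) D∩XN=∅
    with hub-in-one-side sep (λ v v∈ → D∩XN=∅ v v∈ ∘ inj₁) (λ v v∈ → linked v d v∈ d∈) d∈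
  ... | inj₁ D⊆A = inj₂ (inj₂ (Sum.map₂ inj₁
        (nested-if-separator-in-strict-side em conn sep (C₁⊆ c₁ c₁∈) C₂⊆ linked₂ c₂∈ X⊆NC₂ sep'
          (λ v → N-of-interior sep D⊆A (λ u u∈ → D∩XN=∅ u u∈ ∘ inj₂) v ∘ X'⊆ND v))))
  ... | inj₂ D⊆B = Sum.map₂ inj₁
        (nested-if-separator-in-strict-side em conn (sep-swap sep) (C₂⊆ c₂ c₂∈) C₁⊆ linked₁ c₁∈
          (λ v → X⊆NC₁ v ∘ swap) sep'
          (λ v → N-of-interior (sep-swap sep) D⊆B (λ u u∈ → D∩XN=∅ u u∈ ∘ inj₂ ∘ N-∩-comm u) v
                 ∘ X'⊆ND v))

  tight-components-minimal
    : ExcludedMiddle 0ℓ → ∀ {D₁ D₂ x y}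
    → IsComponent G X D₁ → Tight G X D₁ → IsComponent G X D₂ → Tight G X D₂
    → D₁ x → D₂ y → ∀ Y → _⊆_ G Y X → IsSeparator G x y Y → _⊆_ G X Y
  tight-components-minimal em (_ , D₁∩X=∅ , linked₁ , _) (_ , X⊆ND₁) (_ , D₂∩X=∅ , linked₂ , _) (_ , X⊆ND₂)
    x∈ y∈ Y Y⊆X (_ , _ , no-walk) v v∈X with em {Y v}
  ... | yes v∈Y = v∈Y
  ... | no v∉Y with X⊆ND₁ v v∈X | X⊆ND₂ v v∈X
  ...   | _ , u₁ , u₁∈ , e₁ | _ , u₂ , u₂∈ , e₂ = ⊥-elim (no-walk
          (Walk-mono (Outside-antitone Y⊆X D₁∩X=∅) (linked₁ _ u₁ x∈ u₁∈)
            ++ step (Outside-antitone Y⊆X D₁∩X=∅ u₁ u₁∈) (E-sym e₁)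
                 (step v∉Y e₂ (Walk-mono (Outside-antitone Y⊆X D₂∩X=∅) (linked₂ u₂ _ u₂∈ y∈)))))

lemma6p3 : (∀ {ℓ} → ExcludedMiddle ℓ) → (G : Graph) → LocallyFinite G → Connected G
    → (A B A' B' : VSet G)
    → IsTightSeparation G A B → IsTightSeparation G A' B'
    → Nested G A B A' B'
      ⊎ (∃ λ x → ∃ λ y → (_∪_ G (_∩_ G A B) (N G (_∩_ G A B))) x
           × (_∪_ G (_∩_ G A B) (N G (_∩_ G A B))) y
           × IsMinimalSeparator G x y (_∩_ G A' B'))
lemma6p3 em G _ conn A B A' B' tAB (sep' , (D₁ , comp₁ , tight₁ , D₁⊆) , (D₂ , comp₂ , tight₂ , D₂⊆))
  with em {P = ∃ λ x → D₁ x × XN x} | em {P = ∃ λ y → D₂ y × XN y}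
  where
  XN : VSet G
  XN = _∪_ G (_∩_ G A B) (N G (_∩_ G A B))
... | no D₁∩XN=∅ | _ =
  inj₁ (nested-if-tight-component-avoids em conn tAB sep' comp₁ tight₁ λ u u∈ p → D₁∩XN=∅ (u , u∈ , p))
... | yes _ | no D₂∩XN=∅ =
  inj₁ (nested-if-tight-component-avoids em conn tAB sep' comp₂ tight₂ λ u u∈ p → D₂∩XN=∅ (u , u∈ , p))
... | yes (x , x∈D₁ , x∈XN) | yes (y , y∈D₂ , y∈XN) =
  inj₂ (x , y , x∈XN , y∈XN
       , separator-separates sep' (D₁⊆ x x∈D₁) (D₂⊆ y y∈D₂)
       , tight-components-minimal em comp₁ tight₁ comp₂ tight₂ x∈D₁ y∈D₂)
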